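{- Let $(\mathcal{R},1,*,0,+,\leq)$ be a preordered semiring and write $\Box_r A := \mathsf{Grd}_r(\mathsf{Lin}\,A)$ for $r\in\mathcal{R}$ and $A$ a linear formula. Then the following two rules are derivable in the mixed fragment $\vdash_{\mathsf{MS}}$ of Mixed Graded/Linear logic: (i) ($\Box_E$) for all grade vectors $\delta_1,\delta_2$, graded contexts $\Delta_1,\Delta_2$, linear contexts $\Gamma_1,\Gamma_2$, $r\in\mathcal{R}$, linear formulas $A,B$ and terms $l_1,l_2$: if $\delta_2\odot\Delta_2;\Gamma_2\vdash_{\mathsf{MS}} l_1:\Box_r A$ and $(\delta_1,r)\odot(\Delta_1,x:\mathsf{Lin}\,A);\Gamma_1\vdash_{\mathsf{MS}} l_2:B$, then $(\delta_1,\delta_2)\odot(\Delta_1,\Delta_2);(\Gamma_1,\Gamma_2)\vdash_{\mathsf{MS}} \mathsf{let}\ \mathsf{Grd}\ r\ x = l_1\ \mathsf{in}\ l_2 : B$; (ii) ($\Box_I$) for all $\delta,\Delta$, $r\in\mathcal{R}$, linear formula $A$ and term $l$: if $\delta\odot\Delta;\emptyset\vdash_{\mathsf{MS}} l:A$ then $(r*\delta)\odot\Delta;\emptyset\vdash_{\mathsf{MS}}\mathsf{Grd}\ r\ (\mathsf{Lin}\ l):\Box_r A$.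
   Context: Fix a preordered semiring $(\mathcal{R},1,*,0,+,\leq)$: a semiring with a preorder $\leq$ for which $*$ and $+$ are monotone. Graded formulas: $X,Y,Z::=\mathsf{J}\mid X\boxtimes Y\mid \mathsf{Lin}\,A$; linear formulas: $A,B,C::=\mathsf{I}\mid A\otimes B\mid A\multimap B\mid \mathsf{Grd}_r X$ ($r\in\mathcal{R}$). Graded terms $t::=x\mid \mathsf{j}\mid \mathsf{let}\ \mathsf{j}=t_1\ \mathsf{in}\ t_2\mid (t_1,t_2)\mid \mathsf{let}\ (x,y)=t_1\ \mathsf{in}\ t_2\mid \mathsf{Lin}\ l$; linear terms $l::=x\mid \mathsf{i}\mid \mathsf{let}\ \mathsf{i}=l_1\ \mathsf{in}\ l_2\mid (l_1,l_2)\mid \mathsf{let}\ (x,y)=l_1\ \mathsf{in}\ l_2\mid \lambda x.l\mid l_1\,l_2\mid \mathsf{Grd}\ r\ t\mid \mathsf{let}\ \mathsf{Grd}\ r\ x=l_1\ \mathsf{in}\ l_2\mid \mathsf{Unlin}\ z\mid \mathsf{let}\ \mathsf{j}=z\ \mathsf{in}\ l\mid \mathsf{let}\ (x,y)=z\ \mathsf{in}\ l$; $[s/x]u$ is substitution. A grade vector $\delta$ is a finite sequence over $\mathcal{R}$; $\Delta$ is a sequence of graded hypotheses $x:X$, $\Gamma$ a sequence of linear hypotheses $x:A$; $\delta\odot\Delta$ pairs $\delta$ and $\Delta$ of equal length (the $i$-th grade belongs to the $i$-th hypothesis). Commas denote concatenation (with disjoint variables); $r*\delta$ is pointwise scalar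 multiplication, $\delta_1+\delta_2$ pointwise addition, $\delta_1\leq\delta_2$ pointwise order. The judgments $\delta\odot\Delta\vdash_{\mathsf{GS}}t:X$ and $\delta\odot\Delta;\Gamma\vdash_{\mathsf{MS}}l:A$ are defined mutually inductively by the rules (premises $\Rightarrow$ conclusion): GS: (id) $1\odot x:X\vdash x:X$. (unit$^{\mathsf J}_R$) $\emptyset\odot\emptyset\vdash \mathsf{j}:\mathsf{J}$. (unit$^{\mathsf J}_L$) $(\delta_1,\delta_2)\odot(\Delta_1,\Delta_2)\vdash t:X\Rightarrow(\delta_1,r,\delta_2)\odot(\Delta_1,x:\mathsf J,\Delta_2)\vdash \mathsf{let}\ \mathsf j=x\ \mathsf{in}\ t:X$. ($\boxtimes_R$) $\delta_1\odot\Delta_1\vdash t_1:X$, $\delta_2\odot\Delta_2\vdash t_2:Y\Rightarrow(\delta_1,\delta_2)\odot(\Delta_1,\Delta_2)\vdash(t_1,t_2):X\boxtimes Y$. ($\boxtimes_L$) $(\delta_1,r,r,\delta_2)\odot(\Delta_1,x:X,y:Y,\Delta_2)\vdash t:Z\Rightarrow(\delta_1,r,\delta_2)\odot(\Delta_1,z:X\boxtimes Y,\Delta_2)\vdash\mathsf{let}\ (x,y)=z\ \mathsf{in}\ t:Z$. ($\mathsf{Lin}_R$) $\delta\odot\Delta;\emptyset\vdash_{\mathsf{MS}}l:A\Rightarrow\delta\odot\Delta\vdash_{\mathsf{GS}}\mathsf{Lin}\ l:\mathsf{Lin}\,A$. (cut) $\delta_2\odot\Delta_2\vdash t_1:X$,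 $(\delta_1,r,\delta_3)\odot(\Delta_1,x:X,\Delta_3)\vdash t_2:Y\Rightarrow(\delta_1,r*\delta_2,\delta_3)\odot(\Delta_1,\Delta_2,\Delta_3)\vdash[t_1/x]t_2:Y$. (weak) $(\delta_1,\delta_2)\odot(\Delta_1,\Delta_2)\vdash t:Y\Rightarrow(\delta_1,0,\delta_2)\odot(\Delta_1,x:X,\Delta_2)\vdash t:Y$. (cont) $(\delta_1,r_1,r_2,\delta_2)\odot(\Delta_1,x:X,y:X,\Delta_2)\vdash t:Y\Rightarrow(\delta_1,r_1+r_2,\delta_2)\odot(\Delta_1,x:X,\Delta_2)\vdash[x/y]t:Y$. (ex) swapping two adjacent graded hypotheses together with their grades. (sub) $\delta_1\odot\Delta\vdash t:X$, $\delta_1\leq\delta_2\Rightarrow\delta_2\odot\Delta\vdash t:X$. MS: (id) $\emptyset\odot\emptyset;x:A\vdash x:A$. (unit$^{\mathsf I}_R$) $\emptyset\odot\emptyset;\emptyset\vdash\mathsf i:\mathsf I$. (unit$^{\mathsf I}_L$) $\delta\odot\Delta;(\Gamma_1,\Gamma_2)\vdash l:A\Rightarrow\delta\odot\Delta;(\Gamma_1,x:\mathsf I,\Gamma_2)\vdash\mathsf{let}\ \mathsf i=x\ \mathsf{in}\ l:A$. (unit$^{\mathsf J}$-MS) $(\delta_1,\delta_2)\odot(\Delta_1,\Delta_2);\Gamma\vdash l:A\Rightarrow(\delta_1,r,\delta_2)\odot(\Delta_1,x:\mathsf J,\Delta_2);\Gamma\vdash\mathsf{let}\ \mathsf j=x\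 \mathsf{in}\ l:A$. ($\otimes_R$) $\delta_1\odot\Delta_1;\Gamma_1\vdash l_1:A$, $\delta_2\odot\Delta_2;\Gamma_2\vdash l_2:B\Rightarrow(\delta_1,\delta_2)\odot(\Delta_1,\Delta_2);(\Gamma_1,\Gamma_2)\vdash(l_1,l_2):A\otimes B$. ($\otimes_L$) $\delta\odot\Delta;(\Gamma_1,x:A,y:B,\Gamma_2)\vdash l:C\Rightarrow\delta\odot\Delta;(\Gamma_1,z:A\otimes B,\Gamma_2)\vdash\mathsf{let}\ (x,y)=z\ \mathsf{in}\ l:C$. ($\boxtimes$-MS) $(\delta_1,r,r,\delta_2)\odot(\Delta_1,x:X,y:Y,\Delta_2);\Gamma\vdash l:A\Rightarrow(\delta_1,r,\delta_2)\odot(\Delta_1,z:X\boxtimes Y,\Delta_2);\Gamma\vdash\mathsf{let}\ (x,y)=z\ \mathsf{in}\ l:A$. ($\multimap_R$) $\delta\odot\Delta;(\Gamma,x:A)\vdash l:B\Rightarrow\delta\odot\Delta;\Gamma\vdash\lambda x.l:A\multimap B$. ($\multimap_L$) $\delta_2\odot\Delta_2;\Gamma_2\vdash l_1:A$, $\delta_1\odot\Delta_1;(\Gamma_1,x:B,\Gamma_3)\vdash l_2:C\Rightarrow(\delta_1,\delta_2)\odot(\Delta_1,\Delta_2);(\Gamma_1,z:A\multimap B,\Gamma_2,\Gamma_3)\vdash[z\,l_1/x]l_2:C$. ($\mathsf{Grd}_R$) $\delta\odot\Delta\vdash_{\mathsf{GS}}t:X\Rightarrow(r*\delta)\odot\Delta;\emptyset\vdash_{\mathsf{MS}}\mathsf{Grd}\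 r\ t:\mathsf{Grd}_r X$. ($\mathsf{Grd}_L$) $(\delta,r)\odot(\Delta,x:X);\Gamma\vdash l:A\Rightarrow\delta\odot\Delta;(z:\mathsf{Grd}_rX,\Gamma)\vdash\mathsf{let}\ \mathsf{Grd}\ r\ x=z\ \mathsf{in}\ l:A$. ($\mathsf{Lin}_L$) $\delta\odot\Delta;(x:A,\Gamma)\vdash l:B\Rightarrow(\delta,1)\odot(\Delta,z:\mathsf{Lin}\,A);\Gamma\vdash[\mathsf{Unlin}\ z/x]l:B$. (cut) $\delta_2\odot\Delta_2;\Gamma_2\vdash l_1:A$, $\delta_1\odot\Delta_1;(\Gamma_1,x:A,\Gamma_3)\vdash l_2:B\Rightarrow(\delta_1,\delta_2)\odot(\Delta_1,\Delta_2);(\Gamma_1,\Gamma_2,\Gamma_3)\vdash[l_1/x]l_2:B$. (gcut) $\delta_2\odot\Delta_2\vdash_{\mathsf{GS}}t:X$, $(\delta_1,r,\delta_3)\odot(\Delta_1,x:X,\Delta_3);\Gamma\vdash l:B\Rightarrow(\delta_1,r*\delta_2,\delta_3)\odot(\Delta_1,\Delta_2,\Delta_3);\Gamma\vdash[t/x]l:B$. (weak), (cont), (sub) as in GS acting on the graded context (linear context unchanged); (gex) swaps adjacent graded hypotheses with their grades; (ex) swaps adjacent linear hypotheses. -}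

module Defs where

open import Level using (Level; _⊔_) renaming (suc to lsuc)
open import Data.Nat using (ℕ; _≟_)
open import Data.Bool using (if_then_else_)
open import Data.Product using (_×_; _,_; proj₁)
open import Data.List using (List; []; _∷_) renaming (_++_ to _++ₗ_; map to mapₗ)
open import Data.Vec using (Vec; []; _∷_; _++_; map; toList)
open import Data.Vec.Relation.Binary.Pointwise.Inductive using (Pointwise)
open import Data.List.Relation.Unary.Unique.Propositional using (Unique)
open import Relation.Nullary using (does)
open import Relation.Binary.Core using (Rel; _Preserves₂_⟶_⟶_)
open import Relation.Binary.PropositionalEquality using (_≡_)
open import Relation.Binary.Structures using (IsPreorder)
open import Algebra.Structures using (IsSemiring)

record PreorderedSemiring (c ℓ : Level) : Set (lsuc (c ⊔ ℓ)) where
  infixl 7 _*_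
  infixl 6 _+_
  infix 4 _≤_
  field
    Carrier    : Set c
    _+_        : Carrier → Carrier → Carrier
    _*_        : Carrier → Carrier → Carrier
    0#         : Carrier
    1#         : Carrier
    _≤_        : Rel Carrier ℓ
    isSemiring : IsSemiring _≡_ _+_ _*_ 0# 1#
    isPreorder : IsPreorder _≡_ _≤_
    +-mono     : _+_ Preserves₂ _≤_ ⟶ _≤_ ⟶ _≤_
    *-mono     : _*_ Preserves₂ _≤_ ⟶ _≤_ ⟶ _≤_

module MGL {c ℓ : Level} (S : PreorderedSemiring c ℓ) where
  open PreorderedSemiring S renaming (Carrier to R)

  Var : Set
  Var = ℕ

  infixr 6 _⊠_ _⊗_
  infixr 5 _⊸_

  mutual
    data GForm : Set c where
      J   : GForm
      _⊠_ : GForm → GForm → GForm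
      Lin : LForm → GForm

    data LForm : Set c where
      I   : LForm
      _⊗_ : LForm → LForm → LForm
      _⊸_ : LForm → LForm → LForm
      Grd : R → GForm → LForm

  □ : R → LForm → LForm
  □ r A = Grd r (Lin A)

  mutual
    data GTerm : Set c where
      gvar     : Var → GTerm
      j        : GTerm
      letj     : GTerm → GTerm → GTerm
      gpair    : GTerm → GTerm → GTerm
      letgpair : Var → Var → GTerm → GTerm → GTerm
      lin      : LTerm → GTerm

    data LTerm : Set c where
      lvar      : Var → LTerm
      i         : LTerm
      leti      : LTerm → LTerm → LTerm
      lpair     : LTerm → LTerm → LTerm
      letlpair  : Var → Var → LTerm → LTerm → LTerm
      lam       : Var → LTerm → LTerm
      app       : LTerm → LTerm → LTerm
      grd       : R → GTerm → LTerm
      letgrd    : R → Var → LTerm → LTerm → LTerm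
      unlin     : GTerm → LTerm
      letjL     : GTerm → LTerm → LTerm
      letgpairL : Var → Var → GTerm → LTerm → LTerm

  mutual
    gsubG : GTerm → Var → GTerm → GTerm
    gsubG s x (gvar y) = if does (x ≟ y) then s else gvar y
    gsubG s x j = j
    gsubG s x (letj t₁ t₂) = letj (gsubG s x t₁) (gsubG s x t₂)
    gsubG s x (gpair t₁ t₂) = gpair (gsubG s x t₁) (gsubG s x t₂)
    gsubG s x (letgpair y z t₁ t₂) =
      letgpair y z (gsubG s x t₁)
        (if does (x ≟ y) then t₂ else if does (x ≟ z) then t₂ else gsubG s x t₂)
    gsubG s x (lin l) = lin (gsubL s x l)

    gsubL : GTerm → Var → LTerm → LTerm
    gsubL s x (lvar y) = lvar y
    gsubL s x i = i
    gsubL s x (leti l₁ l₂) = leti (gsubL s x l₁) (gsubL s x l₂)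
    gsubL s x (lpair l₁ l₂) = lpair (gsubL s x l₁) (gsubL s x l₂)
    gsubL s x (letlpair y z l₁ l₂) = letlpair y z (gsubL s x l₁) (gsubL s x l₂)
    gsubL s x (lam y l) = lam y (gsubL s x l)
    gsubL s x (app l₁ l₂) = app (gsubL s x l₁) (gsubL s x l₂)
    gsubL s x (grd r t) = grd r (gsubG s x t)
    gsubL s x (letgrd r y l₁ l₂) =
      letgrd r y (gsubL s x l₁) (if does (x ≟ y) then l₂ else gsubL s x l₂)
    gsubL s x (unlin t) = unlin (gsubG s x t)
    gsubL s x (letjL t l) = letjL (gsubG s x t) (gsubL s x l)
    gsubL s x (letgpairL y z t l) =
      letgpairL y z (gsubG s x t)
        (if does (x ≟ y) then l else if does (x ≟ z) then l else gsubL s x l)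

  -- linear term into linear term (graded subterms contain no free linear variables)
  lsubL : LTerm → Var → LTerm → LTerm
  lsubL s x (lvar y) = if does (x ≟ y) then s else lvar y
  lsubL s x i = i
  lsubL s x (leti l₁ l₂) = leti (lsubL s x l₁) (lsubL s x l₂)
  lsubL s x (lpair l₁ l₂) = lpair (lsubL s x l₁) (lsubL s x l₂)
  lsubL s x (letlpair y z l₁ l₂) =
    letlpair y z (lsubL s x l₁)
      (if does (x ≟ y) then l₂ else if does (x ≟ z) then l₂ else lsubL s x l₂)
  lsubL s x (lam y l) = lam y (if does (x ≟ y) then l else lsubL s x l)
  lsubL s x (app l₁ l₂) = app (lsubL s x l₁) (lsubL s x l₂)
  lsubL s x (grd r t) = grd r t
  lsubL s x (letgrd r y l₁ l₂) = letgrd r y (lsubL s x l₁) (lsubL s x l₂)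
  lsubL s x (unlin t) = unlin t
  lsubL s x (letjL t l) = letjL t (lsubL s x l)
  lsubL s x (letgpairL y z t l) = letgpairL y z t (lsubL s x l)

  GHyp : Set c
  GHyp = Var × GForm

  LHyp : Set c
  LHyp = Var × LForm

  LCtx : Set c
  LCtx = List LHyp

  Grades : ℕ → Set c
  Grades n = Vec R n

  GCtx : ℕ → Set c
  GCtx n = Vec GHyp n

  _*ᵥ_ : ∀ {n} → R → Grades n → Grades n
  r *ᵥ δ = map (r *_) δ

  _≤ᵥ_ : ∀ {n} → Grades n → Grades n → Set (c ⊔ ℓ)
  δ₁ ≤ᵥ δ₂ = Pointwise _≤_ δ₁ δ₂

  -- Convention "commas denote concatenation with disjoint variables":
  -- all variables of Δ and Γ are pairwise distinct.
  WF : ∀ {n} → GCtx n → LCtx → Set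
  WF Δ Γ = Unique (toList (map proj₁ Δ) ++ₗ mapₗ proj₁ Γ)

  infix 3 GS MS
  syntax GS δ Δ t X = δ ⊙ Δ ⊢GS t ∶ X
  syntax MS δ Δ Γ l A = δ ⊙ Δ ⨾ Γ ⊢MS l ∶ A

  mutual
    data GS : ∀ {n} → Grades n → GCtx n → GTerm → GForm → Set (c ⊔ ℓ) where
      id : ∀ {x X} → WF ((x , X) ∷ []) [] →
        (1# ∷ []) ⊙ ((x , X) ∷ []) ⊢GS gvar x ∶ X
      unitJR : WF [] [] → [] ⊙ [] ⊢GS j ∶ J
      unitJL : ∀ {n₁ n₂} {δ₁ : Grades n₁} {δ₂ : Grades n₂} {Δ₁ Δ₂ r x t X} →
        (δ₁ ++ δ₂) ⊙ (Δ₁ ++ Δ₂) ⊢GS t ∶ X →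
        WF (Δ₁ ++ (x , J) ∷ Δ₂) [] →
        (δ₁ ++ r ∷ δ₂) ⊙ (Δ₁ ++ (x , J) ∷ Δ₂) ⊢GS letj (gvar x) t ∶ X
      ⊠R : ∀ {n₁ n₂} {δ₁ : Grades n₁} {δ₂ : Grades n₂} {Δ₁ Δ₂ t₁ t₂ X Y} →
        δ₁ ⊙ Δ₁ ⊢GS t₁ ∶ X → δ₂ ⊙ Δ₂ ⊢GS t₂ ∶ Y →
        WF (Δ₁ ++ Δ₂) [] →
        (δ₁ ++ δ₂) ⊙ (Δ₁ ++ Δ₂) ⊢GS gpair t₁ t₂ ∶ X ⊠ Y
      ⊠L : ∀ {n₁ n₂} {δ₁ : Grades n₁} {δ₂ : Grades n₂} {Δ₁ Δ₂ r x y z t X Y Z} →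
        (δ₁ ++ r ∷ r ∷ δ₂) ⊙ (Δ₁ ++ (x , X) ∷ (y , Y) ∷ Δ₂) ⊢GS t ∶ Z →
        WF (Δ₁ ++ (z , X ⊠ Y) ∷ Δ₂) [] →
        (δ₁ ++ r ∷ δ₂) ⊙ (Δ₁ ++ (z , X ⊠ Y) ∷ Δ₂) ⊢GS letgpair x y (gvar z) t ∶ Z
      LinR : ∀ {n} {δ : Grades n} {Δ l A} →
        δ ⊙ Δ ⨾ [] ⊢MS l ∶ A → WF Δ [] →
        δ ⊙ Δ ⊢GS lin l ∶ Lin A
      cut : ∀ {n₁ n₂ n₃} {δ₁ : Grades n₁} {δ₂ : Grades n₂} {δ₃ : Grades n₃}
              {Δ₁ Δ₂ Δ₃ r x t₁ t₂ X Y} →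
        δ₂ ⊙ Δ₂ ⊢GS t₁ ∶ X →
        (δ₁ ++ r ∷ δ₃) ⊙ (Δ₁ ++ (x , X) ∷ Δ₃) ⊢GS t₂ ∶ Y →
        WF (Δ₁ ++ Δ₂ ++ Δ₃) [] →
        (δ₁ ++ (r *ᵥ δ₂) ++ δ₃) ⊙ (Δ₁ ++ Δ₂ ++ Δ₃) ⊢GS gsubG t₁ x t₂ ∶ Y
      weak : ∀ {n₁ n₂} {δ₁ : Grades n₁} {δ₂ : Grades n₂} {Δ₁ Δ₂ x t X Y} →
        (δ₁ ++ δ₂) ⊙ (Δ₁ ++ Δ₂) ⊢GS t ∶ Y →
        WF (Δ₁ ++ (x , X) ∷ Δ₂) [] →
        (δ₁ ++ 0# ∷ δ₂) ⊙ (Δ₁ ++ (x , X) ∷ Δ₂) ⊢GS t ∶ Y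
      cont : ∀ {n₁ n₂} {δ₁ : Grades n₁} {δ₂ : Grades n₂} {Δ₁ Δ₂ r₁ r₂ x y t X Y} →
        (δ₁ ++ r₁ ∷ r₂ ∷ δ₂) ⊙ (Δ₁ ++ (x , X) ∷ (y , X) ∷ Δ₂) ⊢GS t ∶ Y →
        WF (Δ₁ ++ (x , X) ∷ Δ₂) [] →
        (δ₁ ++ (r₁ + r₂) ∷ δ₂) ⊙ (Δ₁ ++ (x , X) ∷ Δ₂) ⊢GS gsubG (gvar x) y t ∶ Y
      ex : ∀ {n₁ n₂} {δ₁ : Grades n₁} {δ₂ : Grades n₂} {Δ₁ Δ₂ r₁ r₂ h₁ h₂ t Y} →
        (δ₁ ++ r₁ ∷ r₂ ∷ δ₂) ⊙ (Δ₁ ++ h₁ ∷ h₂ ∷ Δ₂) ⊢GS t ∶ Y →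
        WF (Δ₁ ++ h₂ ∷ h₁ ∷ Δ₂) [] →
        (δ₁ ++ r₂ ∷ r₁ ∷ δ₂) ⊙ (Δ₁ ++ h₂ ∷ h₁ ∷ Δ₂) ⊢GS t ∶ Y
      sub : ∀ {n} {δ₁ δ₂ : Grades n} {Δ t X} →
        δ₁ ⊙ Δ ⊢GS t ∶ X → δ₁ ≤ᵥ δ₂ → WF Δ [] →
        δ₂ ⊙ Δ ⊢GS t ∶ X

    data MS : ∀ {n} → Grades n → GCtx n → LCtx → LTerm → LForm → Set (c ⊔ ℓ) where
      id : ∀ {x A} → WF [] ((x , A) ∷ []) →
        [] ⊙ [] ⨾ (x , A) ∷ [] ⊢MS lvar x ∶ A
      unitIR : WF [] [] → [] ⊙ [] ⨾ [] ⊢MS i ∶ I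
      unitIL : ∀ {n} {δ : Grades n} {Δ Γ₁ Γ₂ x l A} →
        δ ⊙ Δ ⨾ Γ₁ ++ₗ Γ₂ ⊢MS l ∶ A →
        WF Δ (Γ₁ ++ₗ (x , I) ∷ Γ₂) →
        δ ⊙ Δ ⨾ Γ₁ ++ₗ (x , I) ∷ Γ₂ ⊢MS leti (lvar x) l ∶ A
      unitJMS : ∀ {n₁ n₂} {δ₁ : Grades n₁} {δ₂ : Grades n₂} {Δ₁ Δ₂ Γ r x l A} →
        (δ₁ ++ δ₂) ⊙ (Δ₁ ++ Δ₂) ⨾ Γ ⊢MS l ∶ A →
        WF (Δ₁ ++ (x , J) ∷ Δ₂) Γ →
        (δ₁ ++ r ∷ δ₂) ⊙ (Δ₁ ++ (x , J) ∷ Δ₂) ⨾ Γ ⊢MS letjL (gvar x) l ∶ A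
      ⊗R : ∀ {n₁ n₂} {δ₁ : Grades n₁} {δ₂ : Grades n₂} {Δ₁ Δ₂ Γ₁ Γ₂ l₁ l₂ A B} →
        δ₁ ⊙ Δ₁ ⨾ Γ₁ ⊢MS l₁ ∶ A → δ₂ ⊙ Δ₂ ⨾ Γ₂ ⊢MS l₂ ∶ B →
        WF (Δ₁ ++ Δ₂) (Γ₁ ++ₗ Γ₂) →
        (δ₁ ++ δ₂) ⊙ (Δ₁ ++ Δ₂) ⨾ Γ₁ ++ₗ Γ₂ ⊢MS lpair l₁ l₂ ∶ A ⊗ B
      ⊗L : ∀ {n} {δ : Grades n} {Δ Γ₁ Γ₂ x y z l A B C} →
        δ ⊙ Δ ⨾ Γ₁ ++ₗ (x , A) ∷ (y , B) ∷ Γ₂ ⊢MS l ∶ C →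
        WF Δ (Γ₁ ++ₗ (z , A ⊗ B) ∷ Γ₂) →
        δ ⊙ Δ ⨾ Γ₁ ++ₗ (z , A ⊗ B) ∷ Γ₂ ⊢MS letlpair x y (lvar z) l ∶ C
      ⊠MS : ∀ {n₁ n₂} {δ₁ : Grades n₁} {δ₂ : Grades n₂} {Δ₁ Δ₂ Γ r x y z l X Y A} →
        (δ₁ ++ r ∷ r ∷ δ₂) ⊙ (Δ₁ ++ (x , X) ∷ (y , Y) ∷ Δ₂) ⨾ Γ ⊢MS l ∶ A →
        WF (Δ₁ ++ (z , X ⊠ Y) ∷ Δ₂) Γ →
        (δ₁ ++ r ∷ δ₂) ⊙ (Δ₁ ++ (z , X ⊠ Y) ∷ Δ₂) ⨾ Γ ⊢MS letgpairL x y (gvar z) l ∶ A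
      ⊸R : ∀ {n} {δ : Grades n} {Δ Γ x l A B} →
        δ ⊙ Δ ⨾ Γ ++ₗ (x , A) ∷ [] ⊢MS l ∶ B →
        WF Δ Γ →
        δ ⊙ Δ ⨾ Γ ⊢MS lam x l ∶ A ⊸ B
      ⊸L : ∀ {n₁ n₂} {δ₁ : Grades n₁} {δ₂ : Grades n₂} {Δ₁ Δ₂ Γ₁ Γ₂ Γ₃ x z l₁ l₂ A B C} →
        δ₂ ⊙ Δ₂ ⨾ Γ₂ ⊢MS l₁ ∶ A →
        δ₁ ⊙ Δ₁ ⨾ Γ₁ ++ₗ (x , B) ∷ Γ₃ ⊢MS l₂ ∶ C →
        WF (Δ₁ ++ Δ₂) (Γ₁ ++ₗ (z , A ⊸ B) ∷ Γ₂ ++ₗ Γ₃) →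
        (δ₁ ++ δ₂) ⊙ (Δ₁ ++ Δ₂) ⨾ Γ₁ ++ₗ (z , A ⊸ B) ∷ Γ₂ ++ₗ Γ₃
          ⊢MS lsubL (app (lvar z) l₁) x l₂ ∶ C
      GrdR : ∀ {n} {δ : Grades n} {Δ r t X} →
        δ ⊙ Δ ⊢GS t ∶ X →
        WF Δ [] →
        (r *ᵥ δ) ⊙ Δ ⨾ [] ⊢MS grd r t ∶ Grd r X
      GrdL : ∀ {n} {δ : Grades n} {Δ Γ r x z l X A} →
        (δ ++ r ∷ []) ⊙ (Δ ++ (x , X) ∷ []) ⨾ Γ ⊢MS l ∶ A →
        WF Δ ((z , Grd r X) ∷ Γ) →
        δ ⊙ Δ ⨾ (z , Grd r X) ∷ Γ ⊢MS letgrd r x (lvar z) l ∶ A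
      LinL : ∀ {n} {δ : Grades n} {Δ Γ x z l A B} →
        δ ⊙ Δ ⨾ (x , A) ∷ Γ ⊢MS l ∶ B →
        WF (Δ ++ (z , Lin A) ∷ []) Γ →
        (δ ++ 1# ∷ []) ⊙ (Δ ++ (z , Lin A) ∷ []) ⨾ Γ ⊢MS lsubL (unlin (gvar z)) x l ∶ B
      cut : ∀ {n₁ n₂} {δ₁ : Grades n₁} {δ₂ : Grades n₂} {Δ₁ Δ₂ Γ₁ Γ₂ Γ₃ x l₁ l₂ A B} →
        δ₂ ⊙ Δ₂ ⨾ Γ₂ ⊢MS l₁ ∶ A →
        δ₁ ⊙ Δ₁ ⨾ Γ₁ ++ₗ (x , A) ∷ Γ₃ ⊢MS l₂ ∶ B →
        WF (Δ₁ ++ Δ₂) (Γ₁ ++ₗ Γ₂ ++ₗ Γ₃) →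
        (δ₁ ++ δ₂) ⊙ (Δ₁ ++ Δ₂) ⨾ Γ₁ ++ₗ Γ₂ ++ₗ Γ₃ ⊢MS lsubL l₁ x l₂ ∶ B
      gcut : ∀ {n₁ n₂ n₃} {δ₁ : Grades n₁} {δ₂ : Grades n₂} {δ₃ : Grades n₃}
               {Δ₁ Δ₂ Δ₃ Γ r x t l X B} →
        δ₂ ⊙ Δ₂ ⊢GS t ∶ X →
        (δ₁ ++ r ∷ δ₃) ⊙ (Δ₁ ++ (x , X) ∷ Δ₃) ⨾ Γ ⊢MS l ∶ B →
        WF (Δ₁ ++ Δ₂ ++ Δ₃) Γ →
        (δ₁ ++ (r *ᵥ δ₂) ++ δ₃) ⊙ (Δ₁ ++ Δ₂ ++ Δ₃) ⨾ Γ ⊢MS gsubL t x l ∶ B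
      weak : ∀ {n₁ n₂} {δ₁ : Grades n₁} {δ₂ : Grades n₂} {Δ₁ Δ₂ Γ x l X B} →
        (δ₁ ++ δ₂) ⊙ (Δ₁ ++ Δ₂) ⨾ Γ ⊢MS l ∶ B →
        WF (Δ₁ ++ (x , X) ∷ Δ₂) Γ →
        (δ₁ ++ 0# ∷ δ₂) ⊙ (Δ₁ ++ (x , X) ∷ Δ₂) ⨾ Γ ⊢MS l ∶ B
      cont : ∀ {n₁ n₂} {δ₁ : Grades n₁} {δ₂ : Grades n₂} {Δ₁ Δ₂ Γ r₁ r₂ x y l X B} →
        (δ₁ ++ r₁ ∷ r₂ ∷ δ₂) ⊙ (Δ₁ ++ (x , X) ∷ (y , X) ∷ Δ₂) ⨾ Γ ⊢MS l ∶ B →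
        WF (Δ₁ ++ (x , X) ∷ Δ₂) Γ →
        (δ₁ ++ (r₁ + r₂) ∷ δ₂) ⊙ (Δ₁ ++ (x , X) ∷ Δ₂) ⨾ Γ ⊢MS gsubL (gvar x) y l ∶ B
      gex : ∀ {n₁ n₂} {δ₁ : Grades n₁} {δ₂ : Grades n₂} {Δ₁ Δ₂ Γ r₁ r₂ h₁ h₂ l B} →
        (δ₁ ++ r₁ ∷ r₂ ∷ δ₂) ⊙ (Δ₁ ++ h₁ ∷ h₂ ∷ Δ₂) ⨾ Γ ⊢MS l ∶ B →
        WF (Δ₁ ++ h₂ ∷ h₁ ∷ Δ₂) Γ →
        (δ₁ ++ r₂ ∷ r₁ ∷ δ₂) ⊙ (Δ₁ ++ h₂ ∷ h₁ ∷ Δ₂) ⨾ Γ ⊢MS l ∶ B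
      ex : ∀ {n} {δ : Grades n} {Δ Γ₁ Γ₂ h₁ h₂ l B} →
        δ ⊙ Δ ⨾ Γ₁ ++ₗ h₁ ∷ h₂ ∷ Γ₂ ⊢MS l ∶ B →
        WF Δ (Γ₁ ++ₗ h₂ ∷ h₁ ∷ Γ₂) →
        δ ⊙ Δ ⨾ Γ₁ ++ₗ h₂ ∷ h₁ ∷ Γ₂ ⊢MS l ∶ B
      sub : ∀ {n} {δ₁ δ₂ : Grades n} {Δ Γ l B} →
        δ₁ ⊙ Δ ⨾ Γ ⊢MS l ∶ B → δ₁ ≤ᵥ δ₂ → WF Δ Γ →
        δ₂ ⊙ Δ ⨾ Γ ⊢MS l ∶ B

{-# OPTIONS --safe #-}
module Submission where

-- □_I is Lin_R followed by Grd_R. For □_E, Grd_L introduces a linear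
-- hypothesis z : □_r A for a variable z fresh for the contexts and for l₂;
-- exchange moves z behind Γ₁, and cutting l₁ against z yields
-- let Grd r x = l₁ in l₂, because substituting for z leaves l₂ unchanged.

open import Defs
open import Data.Bool using (true; false; if_then_else_)
open import Data.Nat using (ℕ; suc; _≤_; _≟_)
open import Data.Nat.Properties using (1+n≰n; ≤-totalOrder)
open import Data.List using (List; []; _∷_; [_]) renaming (_++_ to _++ₗ_; map to mapₗ)
open import Data.List.Extrema ≤-totalOrder using (max; xs≤max)
open import Data.List.Membership.Propositional using (_∉_)
open import Data.List.Membership.Propositional.Properties using (∈-++⁺ˡ; ∈-++⁺ʳ)
open import Data.List.Properties using (++-assoc; ++-identityʳ; map-++)
open import Data.List.Relation.Binary.Permutation.Propositional
  using (_↭_; ↭-refl; swap; ↭-sym; ↭⇒↭ₛ; module PermutationReasoning)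
open import Data.List.Relation.Binary.Permutation.Propositional.Properties
  using (shift; shifts; ++⁺ˡ; map⁺)
open import Data.List.Relation.Unary.All using (_∷_) renaming (map to mapAll)
open import Data.List.Relation.Unary.All.Properties using (All¬⇒¬Any; ¬Any⇒All¬; ++⁻ˡ)
open import Data.List.Relation.Unary.Any using (here)
open import Data.List.Relation.Unary.Unique.Propositional using (Unique; []; _∷_)
open import Data.Product using (_×_; _,_; proj₁)
open import Data.Vec using (Vec; []; _∷_; _++_; map; toList)
open import Data.Vec.Properties using (toList-++) renaming (map-++ to mapᵥ-++)
open import Function using (_∘_)
open import Level using (Level)
open import Relation.Binary.PropositionalEquality
  using (_≡_; _≢_; refl; sym; trans; cong; cong₂; subst; subst₂; setoid)
open import Relation.Nullary.Decidable using (does; dec-true; dec-false)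
open import Data.List.Relation.Binary.Permutation.Setoid.Properties (setoid ℕ)
  using (Unique-resp-↭)

Unique-++⁻ˡ : ∀ {a} {A : Set a} (xs : List A) {ys} → Unique (xs ++ₗ ys) → Unique xs
Unique-++⁻ˡ []       _         = []
Unique-++⁻ˡ (x ∷ xs) (x∉ ∷ u) = ++⁻ˡ xs x∉ ∷ Unique-++⁻ˡ xs u

fresh : List ℕ → ℕ
fresh xs = suc (max 0 xs)

fresh-∉ : ∀ xs → fresh xs ∉ xs
fresh-∉ xs = All¬⇒¬Any (mapAll fresh≢ (xs≤max 0 xs))
  where
  fresh≢ : ∀ {y} → y ≤ max 0 xs → fresh xs ≢ y
  fresh≢ y≤max refl = 1+n≰n y≤max

if-else≡then : ∀ {a} {A : Set a} b {x y : A} → y ≡ x → (if b then x else y) ≡ x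
if-else≡then true  _   = refl
if-else≡then false y≡x = y≡x

module _ {c ℓ : Level} (S : PreorderedSemiring c ℓ) where
  open MGL S

  gvars : ∀ {n} → GCtx n → List Var
  gvars Δ = toList (map proj₁ Δ)

  gvars-++ : ∀ {n₁ n₂} (Δ₁ : GCtx n₁) (Δ₂ : GCtx n₂) →
             gvars (Δ₁ ++ Δ₂) ≡ gvars Δ₁ ++ₗ gvars Δ₂
  gvars-++ Δ₁ Δ₂ =
    trans (cong toList (mapᵥ-++ proj₁ Δ₁ Δ₂)) (toList-++ (map proj₁ Δ₁) (map proj₁ Δ₂))

  lvars : LCtx → List Var
  lvars Γ = mapₗ proj₁ Γ

  vars : ∀ {n} → GCtx n → LCtx → List Var
  vars Δ Γ = gvars Δ ++ₗ lvars Γ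

  WF-resp-↭ : ∀ {n} {Δ : GCtx n} {Γ Γ′} → Γ ↭ Γ′ → WF Δ Γ → WF Δ Γ′
  WF-resp-↭ {Δ = Δ} Γ↭Γ′ = Unique-resp-↭ (↭⇒↭ₛ (++⁺ˡ (gvars Δ) (map⁺ proj₁ Γ↭Γ′)))

  WF-∷ : ∀ {n} {Δ : GCtx n} {Γ z A} → z ∉ vars Δ Γ → WF Δ Γ → WF Δ ((z , A) ∷ Γ)
  WF-∷ {Δ = Δ} {Γ} {z} z∉ wf =
    Unique-resp-↭ (↭⇒↭ₛ (↭-sym (shift z (gvars Δ) (lvars Γ)))) (¬Any⇒All¬ _ z∉ ∷ wf)

  WF-++⁻ : ∀ {n₁ n₂} (Δ₁ : GCtx n₁) (Δ₂ : GCtx n₂) Γ₁ Γ₂ →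
           WF (Δ₁ ++ Δ₂) (Γ₁ ++ₗ Γ₂) → WF Δ₁ Γ₁
  WF-++⁻ Δ₁ Δ₂ Γ₁ Γ₂ wf =
    Unique-++⁻ˡ (vars Δ₁ Γ₁) (Unique-resp-↭ (↭⇒↭ₛ regroup) wf)
    where
    open PermutationReasoning
    regroup : vars (Δ₁ ++ Δ₂) (Γ₁ ++ₗ Γ₂) ↭ vars Δ₁ Γ₁ ++ₗ vars Δ₂ Γ₂
    regroup = begin
      gvars (Δ₁ ++ Δ₂) ++ₗ lvars (Γ₁ ++ₗ Γ₂) ≡⟨ cong₂ _++ₗ_ (gvars-++ Δ₁ Δ₂) (map-++ proj₁ Γ₁ Γ₂) ⟩
      (xs₁ ++ₗ xs₂) ++ₗ (ys₁ ++ₗ ys₂)       ≡⟨ ++-assoc xs₁ xs₂ (ys₁ ++ₗ ys₂) ⟩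
      xs₁ ++ₗ xs₂ ++ₗ ys₁ ++ₗ ys₂           ↭⟨ ++⁺ˡ xs₁ (shifts xs₂ ys₁) ⟩
      xs₁ ++ₗ ys₁ ++ₗ xs₂ ++ₗ ys₂           ≡⟨ ++-assoc xs₁ ys₁ (xs₂ ++ₗ ys₂) ⟨
      (xs₁ ++ₗ ys₁) ++ₗ (xs₂ ++ₗ ys₂)       ∎
      where
      xs₁ xs₂ ys₁ ys₂ : List Var
      xs₁ = gvars Δ₁
      xs₂ = gvars Δ₂
      ys₁ = lvars Γ₁
      ys₂ = lvars Γ₂

  MS⇒WF : ∀ {n} {δ : Grades n} {Δ Γ l A} → δ ⊙ Δ ⨾ Γ ⊢MS l ∶ A → WF Δ Γ
  MS⇒WF (id wf)        = wf
  MS⇒WF (unitIR wf)    = wf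
  MS⇒WF (unitIL _ wf)  = wf
  MS⇒WF (unitJMS _ wf) = wf
  MS⇒WF (⊗R _ _ wf)    = wf
  MS⇒WF (⊗L _ wf)      = wf
  MS⇒WF (⊠MS _ wf)     = wf
  MS⇒WF (⊸R _ wf)      = wf
  MS⇒WF (⊸L _ _ wf)    = wf
  MS⇒WF (GrdR _ wf)    = wf
  MS⇒WF (GrdL _ wf)    = wf
  MS⇒WF (LinL _ wf)    = wf
  MS⇒WF (cut _ _ wf)   = wf
  MS⇒WF (gcut _ _ wf)  = wf
  MS⇒WF (weak _ wf)    = wf
  MS⇒WF (cont _ wf)    = wf
  MS⇒WF (gex _ wf)     = wf
  MS⇒WF (ex _ wf)      = wf
  MS⇒WF (sub _ _ wf)   = wf

  module _ {n} {δ : Grades n} {Δ : GCtx n} {l : LTerm} {B : LForm} where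

    exchange : ∀ Γ₁ {h₁ h₂} Γ₂ →
               δ ⊙ Δ ⨾ Γ₁ ++ₗ h₁ ∷ h₂ ∷ Γ₂ ⊢MS l ∶ B →
               δ ⊙ Δ ⨾ Γ₁ ++ₗ h₂ ∷ h₁ ∷ Γ₂ ⊢MS l ∶ B
    exchange Γ₁ _ d = ex d (WF-resp-↭ (++⁺ˡ Γ₁ (swap _ _ ↭-refl)) (MS⇒WF d))

    exchange-to-end : ∀ Γ₁ {h} Γ₂ →
                      δ ⊙ Δ ⨾ Γ₁ ++ₗ h ∷ Γ₂ ⊢MS l ∶ B →
                      δ ⊙ Δ ⨾ Γ₁ ++ₗ Γ₂ ++ₗ [ h ] ⊢MS l ∶ B
    exchange-to-end Γ₁     []       d = d
    exchange-to-end Γ₁ {h} (g ∷ Γ₂) d =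
      subst (λ Γ → δ ⊙ Δ ⨾ Γ ⊢MS l ∶ B) (++-assoc Γ₁ [ g ] (Γ₂ ++ₗ [ h ]))
        (exchange-to-end (Γ₁ ++ₗ [ g ]) Γ₂
          (subst (λ Γ → δ ⊙ Δ ⨾ Γ ⊢MS l ∶ B) (sym (++-assoc Γ₁ [ g ] (h ∷ Γ₂)))
            (exchange Γ₁ Γ₂ d)))

  linVars : LTerm → List Var
  linVars (lvar y)              = [ y ]
  linVars i                     = []
  linVars (leti l₁ l₂)          = linVars l₁ ++ₗ linVars l₂
  linVars (lpair l₁ l₂)         = linVars l₁ ++ₗ linVars l₂
  linVars (letlpair _ _ l₁ l₂)  = linVars l₁ ++ₗ linVars l₂
  linVars (lam _ l)             = linVars l
  linVars (app l₁ l₂)           = linVars l₁ ++ₗ linVars l₂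
  linVars (grd _ _)             = []
  linVars (letgrd _ _ l₁ l₂)    = linVars l₁ ++ₗ linVars l₂
  linVars (unlin _)             = []
  linVars (letjL _ l)           = linVars l
  linVars (letgpairL _ _ _ l)   = linVars l

  lsubL-self : ∀ s z → lsubL s z (lvar z) ≡ s
  lsubL-self s z = cong (if_then s else lvar z) (dec-true (z ≟ z) refl)

  lsubL-fresh : ∀ s z l → z ∉ linVars l → lsubL s z l ≡ l
  lsubL-fresh s z (lvar y) z∉ = cong (if_then s else lvar y) (dec-false (z ≟ y) (z∉ ∘ here))
  lsubL-fresh s z i _ = refl
  lsubL-fresh s z (leti l₁ l₂) z∉ =
    cong₂ leti (lsubL-fresh s z l₁ (z∉ ∘ ∈-++⁺ˡ)) (lsubL-fresh s z l₂ (z∉ ∘ ∈-++⁺ʳ _))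
  lsubL-fresh s z (lpair l₁ l₂) z∉ =
    cong₂ lpair (lsubL-fresh s z l₁ (z∉ ∘ ∈-++⁺ˡ)) (lsubL-fresh s z l₂ (z∉ ∘ ∈-++⁺ʳ _))
  lsubL-fresh s z (letlpair x y l₁ l₂) z∉ =
    cong₂ (letlpair x y) (lsubL-fresh s z l₁ (z∉ ∘ ∈-++⁺ˡ))
      (if-else≡then (does (z ≟ x)) (if-else≡then (does (z ≟ y))
        (lsubL-fresh s z l₂ (z∉ ∘ ∈-++⁺ʳ _))))
  lsubL-fresh s z (lam x l) z∉ =
    cong (lam x) (if-else≡then (does (z ≟ x)) (lsubL-fresh s z l z∉))
  lsubL-fresh s z (app l₁ l₂) z∉ =
    cong₂ app (lsubL-fresh s z l₁ (z∉ ∘ ∈-++⁺ˡ)) (lsubL-fresh s z l₂ (z∉ ∘ ∈-++⁺ʳ _))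
  lsubL-fresh s z (grd _ _) _ = refl
  lsubL-fresh s z (letgrd r x l₁ l₂) z∉ =
    cong₂ (letgrd r x) (lsubL-fresh s z l₁ (z∉ ∘ ∈-++⁺ˡ)) (lsubL-fresh s z l₂ (z∉ ∘ ∈-++⁺ʳ _))
  lsubL-fresh s z (unlin _) _ = refl
  lsubL-fresh s z (letjL t l) z∉ = cong (letjL t) (lsubL-fresh s z l z∉)
  lsubL-fresh s z (letgpairL x y t l) z∉ = cong (letgpairL x y t) (lsubL-fresh s z l z∉)

  □-intro : ∀ {n} {δ : Grades n} {Δ : GCtx n} {r A l} →
            δ ⊙ Δ ⨾ [] ⊢MS l ∶ A → (r *ᵥ δ) ⊙ Δ ⨾ [] ⊢MS grd r (lin l) ∶ □ r A
  □-intro d = GrdR (LinR d (MS⇒WF d)) (MS⇒WF d)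

  □-elim : ∀ {n₁ n₂} {δ₁ : Grades n₁} {δ₂ : Grades n₂} {Δ₁ : GCtx n₁} {Δ₂ : GCtx n₂}
             {Γ₁ Γ₂ r A B l₁ l₂ x} →
           δ₂ ⊙ Δ₂ ⨾ Γ₂ ⊢MS l₁ ∶ □ r A →
           (δ₁ ++ r ∷ []) ⊙ (Δ₁ ++ (x , Lin A) ∷ []) ⨾ Γ₁ ⊢MS l₂ ∶ B →
           WF (Δ₁ ++ Δ₂) (Γ₁ ++ₗ Γ₂) →
           (δ₁ ++ δ₂) ⊙ (Δ₁ ++ Δ₂) ⨾ Γ₁ ++ₗ Γ₂ ⊢MS letgrd r x l₁ l₂ ∶ B
  □-elim {δ₁ = δ₁} {δ₂} {Δ₁} {Δ₂} {Γ₁} {Γ₂} {r} {A} {B} {l₁} {l₂} {x} d₁ d₂ wf =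
    subst₂ (λ Γ l → (δ₁ ++ δ₂) ⊙ (Δ₁ ++ Δ₂) ⨾ Γ₁ ++ₗ Γ ⊢MS l ∶ B)
      (++-identityʳ Γ₂)
      (cong₂ (letgrd r x) (lsubL-self l₁ z) (lsubL-fresh l₁ z l₂ (z∉ ∘ ∈-++⁺ʳ _)))
      (cut d₁ unboxed (subst (λ Γ → WF (Δ₁ ++ Δ₂) (Γ₁ ++ₗ Γ)) (sym (++-identityʳ Γ₂)) wf))
    where
    z : Var
    z = fresh (vars Δ₁ Γ₁ ++ₗ linVars l₂)

    z∉ : z ∉ vars Δ₁ Γ₁ ++ₗ linVars l₂
    z∉ = fresh-∉ (vars Δ₁ Γ₁ ++ₗ linVars l₂)

    unboxed : δ₁ ⊙ Δ₁ ⨾ Γ₁ ++ₗ (z , □ r A) ∷ [] ⊢MS letgrd r x (lvar z) l₂ ∶ B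
    unboxed = exchange-to-end [] Γ₁ (GrdL d₂ (WF-∷ {A = □ r A} (z∉ ∘ ∈-++⁺ˡ) (WF-++⁻ Δ₁ Δ₂ Γ₁ Γ₂ wf)))

lemma3 : ∀ {c ℓ} (S : PreorderedSemiring c ℓ) →
    let open PreorderedSemiring S renaming (Carrier to R) in
    let open MGL S in
    -- (i) □_E
    (∀ {n₁ n₂} {δ₁ : Vec R n₁} {δ₂ : Vec R n₂} {Δ₁ : GCtx n₁} {Δ₂ : GCtx n₂}
       {Γ₁ Γ₂ : LCtx} {r : R} {A B : LForm} {l₁ l₂ : LTerm} {x : Var} →
       MS δ₂ Δ₂ Γ₂ l₁ (□ r A) →
       MS (δ₁ ++ r ∷ []) (Δ₁ ++ (x , Lin A) ∷ []) Γ₁ l₂ B →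
       WF (Δ₁ ++ Δ₂) (Γ₁ ++ₗ Γ₂) →
       MS (δ₁ ++ δ₂) (Δ₁ ++ Δ₂) (Γ₁ ++ₗ Γ₂) (letgrd r x l₁ l₂) B)
    ×
    -- (ii) □_I
    (∀ {n} {δ : Vec R n} {Δ : GCtx n} {r : R} {A : LForm} {l : LTerm} →
       MS δ Δ [] l A →
       MS (r *ᵥ δ) Δ [] (grd r (lin l)) (□ r A))
lemma3 S = □-elim S , □-intro S
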